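{- Let $n\ge 3$ and let $r_n(q)=R(K_n)(q)$ be the reliability polynomial of the complete graph $K_n$. Then for all $q\in[0,1]$, \[ \frac{r_n(q)}{(1-q)^2} \le \frac12\binom{n}{2}^2, \] where the left-hand side denotes the polynomial $r_n(q)/(1-q)^2$ (the polynomial $r_n$ is divisible by $(1-q)^2$ when $n\ge3$).
   Context: The reliability polynomial $R(G)(q)$ of a finite graph $G$ with $m$ edges is the probability that $G$ remains connected when each edge fails independently with probability $q$; it equals $\sum_{i=0}^m N_i(1-q)^iq^{m-i}$ where $N_i$ is the number of connected spanning subgraphs with $i$ edges.
   Formalization: The variable $q$ ranges only over the rational numbers in $[0,1]$ rather than over all of $[0,1]$. -}

module Defs where

open import Data.Nat as ℕ using (ℕ; zero; suc)
open import Data.Fin as F using (Fin; toℕ)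
open import Data.Bool using (Bool; true; false; _∧_; _∨_; if_then_else_)
open import Data.List using (List; []; _∷_; map; concatMap; filter; allFin; length; upTo; foldr)
open import Data.Bool.ListAction using (any; all)
open import Data.Product using (_×_; _,_; proj₁; proj₂)
open import Data.Integer using (+_)
open import Data.Rational using (ℚ; _+_; _*_; _-_; 0ℚ; 1ℚ; _/_)
open import Relation.Nullary.Decidable using (⌊_⌋)

fromℕ : ℕ → ℚ
fromℕ n = + n / 1

_^_ : ℚ → ℕ → ℚ
x ^ zero  = 1ℚ
x ^ suc k = x * (x ^ k)

evalPoly : List ℚ → ℚ → ℚ
evalPoly []       x = 0ℚ
evalPoly (a ∷ as) x = a + x * evalPoly as x

-- The complete graph K_n on vertex set Fin n:
-- its edges are the unordered pairs {i , j} with i < j (listed once each).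

edgesK : (n : ℕ) → List (Fin n × Fin n)
edgesK n = concatMap (λ i → map (i ,_) (filter (λ j → toℕ i ℕ.<? toℕ j) (allFin n))) (allFin n)

-- a spanning subgraph of K_n is a subset of the edge set, encoded as a list of
-- booleans (one per edge of edgesK n); all such selections of a list of length m:
selections : ℕ → List (List Bool)
selections zero    = [] ∷ []
selections (suc m) = map (true ∷_) (selections m) Data.List.++ map (false ∷_) (selections m)

chosen : ∀ {A : Set} → List A → List Bool → List A
chosen []       _            = []
chosen (_ ∷ _)  []           = []
chosen (e ∷ es) (true  ∷ bs) = e ∷ chosen es bs
chosen (e ∷ es) (false ∷ bs) = chosen es bs

countTrue : List Bool → ℕ
countTrue []           = 0
countTrue (true  ∷ bs) = suc (countTrue bs)
countTrue (false ∷ bs) = countTrue bs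

adjacent : ∀ {n} → List (Fin n × Fin n) → Fin n → Fin n → Bool
adjacent E u v = any (λ e → (⌊ proj₁ e F.≟ u ⌋ ∧ ⌊ proj₂ e F.≟ v ⌋) ∨ (⌊ proj₁ e F.≟ v ⌋ ∧ ⌊ proj₂ e F.≟ u ⌋)) E

reach : ∀ {n} → List (Fin n × Fin n) → ℕ → Fin n → Fin n → Bool
reach E zero    u v = ⌊ u F.≟ v ⌋
reach E (suc k) u v = reach E k u v ∨ any (λ w → reach E k u w ∧ adjacent E w v) (allFin _)

-- the graph (Fin n, E) is connected: any two vertices are joined by a walk
-- (a walk between two vertices can always be shortened to one of length ≤ n)
connected : ∀ {n} → List (Fin n × Fin n) → Bool
connected {n} E = all (λ u → all (λ v → reach E n u v) (allFin n)) (allFin n)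

mK : ℕ → ℕ
mK n = length (edgesK n)

N : ℕ → ℕ → ℕ
N n i = length (filter (λ s → Data.Bool._≟_ (connected (chosen (edgesK n) s) ∧ ⌊ countTrue s ℕ.≟ i ⌋) true)
                       (selections (mK n)))

r : ℕ → ℚ → ℚ
r n q = foldr _+_ 0ℚ (map (λ i → fromℕ (N n i) * ((1ℚ - q) ^ i) * (q ^ (mK n ℕ.∸ i))) (upTo (suc (mK n))))

{-# OPTIONS --safe #-}
module Submission where

-- Write p = 1 - q and m = C(n,2) for the number of edges of Kₙ. Summing over edge
-- sets S instead of over sizes i, rₙ(q) = Σ_S [S connected] p^|S| q^(m-|S|). For n ≥ 3
-- a spanning subgraph with at most one edge has an isolated vertex, so every connected
-- S has at least two edges and rₙ(q) is at most the probability that m independent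
-- trials with success probability p have at least two successes. By the union bound
-- over pairs of trials this is at most C(m,2) p². Cancelling p² bounds Q by C(m,2) on
-- [0,1), continuity of Q extends the bound to q = 1, and C(m,2) ≤ m²/2.

open import Defs
open import Data.Nat as ℕ using (ℕ; zero; suc; _≥_; _∸_; z≤n; s≤s)
import Data.Nat.Properties as ℕₚ
open import Data.Nat.Combinatorics using (_C_; nCk+nC[k+1]≡[n+1]C[k+1]; nC1≡n)
open import Data.Nat.Coprimality using (1-coprimeTo)
import Data.Nat.Coprimality as Coprime
open import Data.Nat.Solver using () renaming (module +-*-Solver to ℕ-Solver)
import Data.Integer as ℤ
import Data.Integer.Properties as ℤₚ
open import Data.Rational
  using (ℚ; mkℚ; _≤_; _<_; _+_; _*_; _-_; -_; 1/_; ∣_∣; 0ℚ; 1ℚ; ½; NonZero; Positive; positive; nonNegative)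
import Data.Rational.Properties as ℚ
open import Data.Rational.Solver using (module +-*-Solver)
open import Data.Bool using (Bool; true; false; T; _∧_)
import Data.Bool as Bool
open import Data.Bool.Properties using (T-∨; T-∧)
open import Data.Fin using (Fin; toℕ)
import Data.Fin as Fin
open import Data.Product using (_×_; _,_; proj₁; proj₂; ∃-syntax)
open import Data.Sum using (inj₁; inj₂)
open import Data.List using (List; []; _∷_; _++_; map; foldr; filter; length; upTo; allFin; tabulate; concatMap)
import Data.List.Properties as List
open import Data.List.Relation.Unary.All as All using (All; []; _∷_; universal)
open import Data.List.Relation.Unary.All.Properties using (++⁺; map⁺; tabulate⁺; all⁺)
open import Data.List.Relation.Unary.Any using (satisfied)
open import Data.List.Relation.Unary.Any.Properties using (any⁻)
open import Data.List.Membership.Propositional.Properties using (∈-allFin)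
open import Function using (_∘_; id)
open import Function.Bundles using (Equivalence)
open import Level using (0ℓ)
open import Relation.Binary.PropositionalEquality
open import Relation.Nullary using (¬_; contradiction; yes; no)
open import Relation.Nullary.Decidable using (⌊_⌋; does; isYes≗does; toWitness)
open import Relation.Unary using (Pred; Decidable)

private
  variable
    A : Set

-- Rational arithmetic

fromℕ≡mkℚ : ∀ n → fromℕ n ≡ mkℚ (ℤ.+ n) 0 (Coprime.sym (1-coprimeTo n))
fromℕ≡mkℚ n = ℚ.normalize-coprime (Coprime.sym (1-coprimeTo n))

fromℕ-+ : ∀ a b → fromℕ (a ℕ.+ b) ≡ fromℕ a + fromℕ b
fromℕ-+ a b rewrite fromℕ≡mkℚ a | fromℕ≡mkℚ b =
  ℚ./-cong {p₂ = ℤ.+ a ℤ.* ℤ.+ 1 ℤ.+ ℤ.+ b ℤ.* ℤ.+ 1}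
    (cong₂ ℤ._+_ (sym (ℤₚ.*-identityʳ (ℤ.+ a))) (sym (ℤₚ.*-identityʳ (ℤ.+ b)))) refl

0≤fromℕ : ∀ n → 0ℚ ≤ fromℕ n
0≤fromℕ n = ℚ.nonNegative⁻¹ (fromℕ n) {{ℚ.normalize-nonNeg n 1}}

0≤1 : 0ℚ ≤ 1ℚ
0≤1 = ℚ.nonNegative⁻¹ 1ℚ

p≤∣p∣ : ∀ p → p ≤ ∣ p ∣
p≤∣p∣ p with ℚ.≤-total 0ℚ p
... | inj₁ 0≤p = ℚ.≤-reflexive (sym (ℚ.0≤p⇒∣p∣≡p 0≤p))
... | inj₂ p≤0 = ℚ.≤-trans p≤0 (ℚ.0≤∣p∣ p)

p≤q⇒0≤q-p : ∀ {p q} → p ≤ q → 0ℚ ≤ q - p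
p≤q⇒0≤q-p {p} {q} p≤q = subst (_≤ q - p) (ℚ.+-inverseʳ p) (ℚ.+-monoˡ-≤ (- p) p≤q)

p<q⇒0<q-p : ∀ {p q} → p < q → 0ℚ < q - p
p<q⇒0<q-p {p} {q} p<q = subst (_< q - p) (ℚ.+-inverseʳ p) (ℚ.+-monoˡ-< (- p) p<q)

*-monoˡ-≤ : ∀ {r p q} → 0ℚ ≤ r → p ≤ q → r * p ≤ r * q
*-monoˡ-≤ {r} 0≤r = ℚ.*-monoˡ-≤-nonNeg r {{nonNegative 0≤r}}

*-monoʳ-≤ : ∀ {r p q} → 0ℚ ≤ r → p ≤ q → p * r ≤ q * r
*-monoʳ-≤ {r} 0≤r = ℚ.*-monoʳ-≤-nonNeg r {{nonNegative 0≤r}}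

0≤* : ∀ {p q} → 0ℚ ≤ p → 0ℚ ≤ q → 0ℚ ≤ p * q
0≤* {p} {q} 0≤p 0≤q = subst (_≤ p * q) (ℚ.*-zeroˡ q) (*-monoʳ-≤ 0≤q 0≤p)

0≤^ : ∀ {p} → 0ℚ ≤ p → ∀ k → 0ℚ ≤ p ^ k
0≤^ 0≤p zero    = 0≤1
0≤^ 0≤p (suc k) = 0≤* 0≤p (0≤^ 0≤p k)

0<^ : ∀ {p} → 0ℚ < p → ∀ k → 0ℚ < p ^ k
0<^     0<p zero    = ℚ.positive⁻¹ 1ℚ
0<^ {p} 0<p (suc k) = ℚ.positive⁻¹ (p * p ^ k) {{ℚ.pos*pos⇒pos p {{positive 0<p}} (p ^ k) {{positive (0<^ 0<p k)}}}}

≤1⇒*-≤ : ∀ {p q} → 0ℚ ≤ q → p ≤ 1ℚ → p * q ≤ q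
≤1⇒*-≤ {p} {q} 0≤q p≤1 = subst (p * q ≤_) (ℚ.*-identityˡ q) (*-monoʳ-≤ 0≤q p≤1)

-- Finite sums

𝟙 : Bool → ℚ
𝟙 true  = 1ℚ
𝟙 false = 0ℚ

0≤𝟙 : ∀ b → 0ℚ ≤ 𝟙 b
0≤𝟙 true  = 0≤1
0≤𝟙 false = ℚ.≤-refl

𝟙-mono : ∀ {b c a} → (T b → T c) → 0ℚ ≤ a → 𝟙 b * a ≤ 𝟙 c * a
𝟙-mono {true}  {true}  b⇒c 0≤a = ℚ.≤-refl
𝟙-mono {true}  {false} b⇒c 0≤a with () ← b⇒c _
𝟙-mono {false} {c}     b⇒c 0≤a = *-monoʳ-≤ 0≤a (0≤𝟙 c)

Sum : (A → ℚ) → List A → ℚ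
Sum f []       = 0ℚ
Sum f (x ∷ xs) = f x + Sum f xs

foldr-+-map : ∀ (f : A → ℚ) xs → foldr _+_ 0ℚ (map f xs) ≡ Sum f xs
foldr-+-map f []       = refl
foldr-+-map f (x ∷ xs) = cong (f x +_) (foldr-+-map f xs)

module _ {f g : A → ℚ} where

  Sum-cong : ∀ {xs} → All (λ x → f x ≡ g x) xs → Sum f xs ≡ Sum g xs
  Sum-cong []             = refl
  Sum-cong (fx≡gx ∷ f≡g) = cong₂ _+_ fx≡gx (Sum-cong f≡g)

  Sum-mono : ∀ {xs} → All (λ x → f x ≤ g x) xs → Sum f xs ≤ Sum g xs
  Sum-mono []             = ℚ.≤-refl
  Sum-mono (fx≤gx ∷ f≤g) = ℚ.+-mono-≤ fx≤gx (Sum-mono f≤g)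

  Sum-+ : ∀ xs → Sum (λ x → f x + g x) xs ≡ Sum f xs + Sum g xs
  Sum-+ []       = sym (ℚ.+-identityˡ 0ℚ)
  Sum-+ (x ∷ xs) = trans (cong ((f x + g x) +_) (Sum-+ xs))
    (solve 4 (λ a b c d → (a :+ b) :+ (c :+ d) := (a :+ c) :+ (b :+ d)) refl (f x) (g x) (Sum f xs) (Sum g xs))
    where open +-*-Solver

Sum-++ : ∀ (f : A → ℚ) xs ys → Sum f (xs ++ ys) ≡ Sum f xs + Sum f ys
Sum-++ f []       ys = sym (ℚ.+-identityˡ (Sum f ys))
Sum-++ f (x ∷ xs) ys = trans (cong (f x +_) (Sum-++ f xs ys)) (sym (ℚ.+-assoc (f x) (Sum f xs) (Sum f ys)))

Sum-map : ∀ {B : Set} (f : B → ℚ) (g : A → B) xs → Sum f (map g xs) ≡ Sum (f ∘ g) xs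
Sum-map f g []       = refl
Sum-map f g (x ∷ xs) = cong (f (g x) +_) (Sum-map f g xs)

Sum-*ˡ : ∀ c (f : A → ℚ) xs → Sum (λ x → c * f x) xs ≡ c * Sum f xs
Sum-*ˡ c f []       = sym (ℚ.*-zeroʳ c)
Sum-*ˡ c f (x ∷ xs) = trans (cong (c * f x +_) (Sum-*ˡ c f xs)) (sym (ℚ.*-distribˡ-+ c (f x) (Sum f xs)))

Sum-*ʳ : ∀ c (f : A → ℚ) xs → Sum (λ x → f x * c) xs ≡ Sum f xs * c
Sum-*ʳ c f []       = sym (ℚ.*-zeroˡ c)
Sum-*ʳ c f (x ∷ xs) = trans (cong (f x * c +_) (Sum-*ʳ c f xs)) (sym (ℚ.*-distribʳ-+ c (f x) (Sum f xs)))

Sum-comm : ∀ {B : Set} (g : A → B → ℚ) xs ys →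
           Sum (λ x → Sum (g x) ys) xs ≡ Sum (λ y → Sum (λ x → g x y) xs) ys
Sum-comm g []       ys = sym (trans (Sum-*ˡ 0ℚ (λ _ → 0ℚ) ys) (ℚ.*-zeroˡ (Sum (λ _ → 0ℚ) ys)))
Sum-comm g (x ∷ xs) ys = trans (cong (Sum (g x) ys +_) (Sum-comm g xs ys)) (sym (Sum-+ ys))

Sum-upTo-suc : ∀ (f : ℕ → ℚ) k → Sum f (upTo (suc k)) ≡ f 0 + Sum (f ∘ suc) (upTo k)
Sum-upTo-suc f k = cong (f 0 +_) (trans (cong (Sum f) (sym (List.map-upTo suc k))) (Sum-map f suc (upTo k)))

fromℕ-count : ∀ (b : A → Bool) xs → fromℕ (length (filter (λ x → b x Bool.≟ true) xs)) ≡ Sum (𝟙 ∘ b) xs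
fromℕ-count b []       = refl
fromℕ-count b (x ∷ xs) with b x
... | true  = trans (fromℕ-+ 1 (length (filter (λ x → b x Bool.≟ true) xs))) (cong (1ℚ +_) (fromℕ-count b xs))
... | false = trans (fromℕ-count b xs) (sym (ℚ.+-identityˡ (Sum (𝟙 ∘ b) xs)))

⌊suc≟suc⌋ : ∀ j i → ⌊ suc j ℕ.≟ suc i ⌋ ≡ ⌊ j ℕ.≟ i ⌋
⌊suc≟suc⌋ j i = trans (isYes≗does (suc j ℕ.≟ suc i)) (sym (isYes≗does (j ℕ.≟ i)))

Sum-δ : ∀ (v : ℕ → ℚ) {k j} → j ℕ.< k → Sum (λ i → 𝟙 ⌊ j ℕ.≟ i ⌋ * v i) (upTo k) ≡ v j
Sum-δ v {suc k} {zero} _ = begin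
  Sum (λ i → 𝟙 ⌊ 0 ℕ.≟ i ⌋ * v i) (upTo (suc k))    ≡⟨ Sum-upTo-suc (λ i → 𝟙 ⌊ 0 ℕ.≟ i ⌋ * v i) k ⟩
  1ℚ * v 0 + Sum (λ i → 0ℚ * v (suc i)) (upTo k)   ≡⟨ cong₂ _+_ (ℚ.*-identityˡ (v 0)) (Sum-*ˡ 0ℚ (v ∘ suc) (upTo k)) ⟩
  v 0 + 0ℚ * Sum (v ∘ suc) (upTo k)                ≡⟨ cong (v 0 +_) (ℚ.*-zeroˡ (Sum (v ∘ suc) (upTo k))) ⟩
  v 0 + 0ℚ                                         ≡⟨ ℚ.+-identityʳ (v 0) ⟩
  v 0                                              ∎
  where open ≡-Reasoning
Sum-δ v {suc k} {suc j} (s≤s j<k) = begin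
  Sum (λ i → 𝟙 ⌊ suc j ℕ.≟ i ⌋ * v i) (upTo (suc k))                    ≡⟨ Sum-upTo-suc (λ i → 𝟙 ⌊ suc j ℕ.≟ i ⌋ * v i) k ⟩
  0ℚ * v 0 + Sum (λ i → 𝟙 ⌊ suc j ℕ.≟ suc i ⌋ * v (suc i)) (upTo k)   ≡⟨ cong₂ _+_ (ℚ.*-zeroˡ (v 0)) (Sum-cong
                                                                          (universal (λ i → cong (λ b → 𝟙 b * v (suc i)) (⌊suc≟suc⌋ j i)) (upTo k))) ⟩
  0ℚ + Sum (λ i → 𝟙 ⌊ j ℕ.≟ i ⌋ * v (suc i)) (upTo k)                 ≡⟨ ℚ.+-identityˡ _ ⟩
  Sum (λ i → 𝟙 ⌊ j ℕ.≟ i ⌋ * v (suc i)) (upTo k)                      ≡⟨ Sum-δ (v ∘ suc) j<k ⟩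
  v (suc j)                                                           ∎
  where open ≡-Reasoning

Sum-guarded-δ : ∀ b (v : ℕ → ℚ) {k j} → j ℕ.< k → Sum (λ i → 𝟙 (b ∧ ⌊ j ℕ.≟ i ⌋) * v i) (upTo k) ≡ 𝟙 b * v j
Sum-guarded-δ true  v j<k = trans (Sum-δ v j<k) (sym (ℚ.*-identityˡ _))
Sum-guarded-δ false v {k} {j} _ =
  trans (Sum-*ˡ 0ℚ v (upTo k)) (trans (ℚ.*-zeroˡ (Sum v (upTo k))) (sym (ℚ.*-zeroˡ (v j))))

Sum-fibres : ∀ (c : A → Bool) (f : A → ℕ) (v : ℕ → ℚ) k xs → All (λ x → f x ℕ.< k) xs →
  Sum (λ i → fromℕ (length (filter (λ x → (c x ∧ ⌊ f x ℕ.≟ i ⌋) Bool.≟ true) xs)) * v i) (upTo k)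
    ≡ Sum (λ x → 𝟙 (c x) * v (f x)) xs
Sum-fibres c f v k xs f<k = begin
  Sum (λ i → fromℕ (length (filter (λ x → (c x ∧ ⌊ f x ℕ.≟ i ⌋) Bool.≟ true) xs)) * v i) (upTo k)
    ≡⟨ Sum-cong (universal (λ i → cong (_* v i) (fromℕ-count (λ x → c x ∧ ⌊ f x ℕ.≟ i ⌋) xs)) (upTo k)) ⟩
  Sum (λ i → Sum (λ x → 𝟙 (c x ∧ ⌊ f x ℕ.≟ i ⌋)) xs * v i) (upTo k)
    ≡⟨ Sum-cong (universal (λ i → sym (Sum-*ʳ (v i) _ xs)) (upTo k)) ⟩
  Sum (λ i → Sum (λ x → 𝟙 (c x ∧ ⌊ f x ℕ.≟ i ⌋) * v i) xs) (upTo k)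
    ≡⟨ Sum-comm _ (upTo k) xs ⟩
  Sum (λ x → Sum (λ i → 𝟙 (c x ∧ ⌊ f x ℕ.≟ i ⌋) * v i) (upTo k)) xs
    ≡⟨ Sum-cong (All.map (λ {x} → Sum-guarded-δ (c x) v) f<k) ⟩
  Sum (λ x → 𝟙 (c x) * v (f x)) xs
    ∎
  where open ≡-Reasoning

-- Binomial tails

countTrue≤length : ∀ s → countTrue s ℕ.≤ length s
countTrue≤length []          = z≤n
countTrue≤length (true ∷ s)  = s≤s (countTrue≤length s)
countTrue≤length (false ∷ s) = ℕₚ.m≤n⇒m≤1+n (countTrue≤length s)

length-selections : ∀ m → All (λ s → length s ≡ m) (selections m)
length-selections zero    = refl ∷ []
length-selections (suc m) = ++⁺ (map⁺ (All.map (cong suc) (length-selections m)))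
                                (map⁺ (All.map (cong suc) (length-selections m)))

≤ᵇ-suc : ∀ j c → (j ℕ.≤ᵇ suc c) ≡ (ℕ.pred j ℕ.≤ᵇ c)
≤ᵇ-suc zero          c = refl
≤ᵇ-suc (suc zero)    c = refl
≤ᵇ-suc (suc (suc j)) c = refl

module _ (p q : ℚ) where

  weight : List Bool → ℚ
  weight []          = 1ℚ
  weight (true ∷ s)  = p * weight s
  weight (false ∷ s) = q * weight s

  weight≡^ : ∀ s → weight s ≡ p ^ countTrue s * q ^ (length s ∸ countTrue s)
  weight≡^ []          = refl
  weight≡^ (true ∷ s)  = trans (cong (p *_) (weight≡^ s)) (sym (ℚ.*-assoc p _ _))
  weight≡^ (false ∷ s) = begin
    q * weight s                              ≡⟨ cong (q *_) (weight≡^ s) ⟩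
    q * (p ^ c * q ^ (length s ∸ c))          ≡⟨ solve 3 (λ q a b → q :* (a :* b) := a :* (q :* b)) refl q (p ^ c) _ ⟩
    p ^ c * q ^ suc (length s ∸ c)            ≡⟨ cong (λ k → p ^ c * q ^ k) (sym (ℕₚ.+-∸-assoc 1 (countTrue≤length s))) ⟩
    p ^ c * q ^ (suc (length s) ∸ c)          ∎
    where
    open ≡-Reasoning
    open +-*-Solver
    c = countTrue s

  binomialTail : ℕ → ℕ → ℚ
  binomialTail m j = Sum (λ s → 𝟙 (j ℕ.≤ᵇ countTrue s) * weight s) (selections m)

  binomialTail-suc : ∀ m j → binomialTail (suc m) j ≡ p * binomialTail m (ℕ.pred j) + q * binomialTail m j
  binomialTail-suc m j = begin
    Sum g (map (true ∷_) S ++ map (false ∷_) S)                 ≡⟨ Sum-++ g (map (true ∷_) S) (map (false ∷_) S) ⟩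
    Sum g (map (true ∷_) S) + Sum g (map (false ∷_) S)          ≡⟨ cong₂ _+_ (Sum-map g (true ∷_) S) (Sum-map g (false ∷_) S) ⟩
    Sum (g ∘ (true ∷_)) S + Sum (g ∘ (false ∷_)) S              ≡⟨ cong₂ _+_ (Sum-cong (universal g-true S)) (Sum-cong (universal g-false S)) ⟩
    Sum (λ s → p * gₚ s) S + Sum (λ s → q * g s) S              ≡⟨ cong₂ _+_ (Sum-*ˡ p gₚ S) (Sum-*ˡ q g S) ⟩
    p * binomialTail m (ℕ.pred j) + q * binomialTail m j        ∎
    where
    open ≡-Reasoning
    open +-*-Solver
    S = selections m
    g gₚ : List Bool → ℚ
    g  s = 𝟙 (j ℕ.≤ᵇ countTrue s) * weight s
    gₚ s = 𝟙 (ℕ.pred j ℕ.≤ᵇ countTrue s) * weight s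
    g-true : ∀ s → g (true ∷ s) ≡ p * gₚ s
    g-true s rewrite ≤ᵇ-suc j (countTrue s) =
      solve 3 (λ a p w → a :* (p :* w) := p :* (a :* w)) refl (𝟙 (ℕ.pred j ℕ.≤ᵇ countTrue s)) p (weight s)
    g-false : ∀ s → g (false ∷ s) ≡ q * g s
    g-false s = solve 3 (λ a q w → a :* (q :* w) := q :* (a :* w)) refl (𝟙 (j ℕ.≤ᵇ countTrue s)) q (weight s)

  module _ (0≤p : 0ℚ ≤ p) (0≤q : 0ℚ ≤ q) (p+q≤1 : p + q ≤ 1ℚ) where

    q≤1 : q ≤ 1ℚ
    q≤1 = ℚ.≤-trans (subst (_≤ p + q) (ℚ.+-identityˡ q) (ℚ.+-monoˡ-≤ q 0≤p)) p+q≤1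

    binomialTail≤ : ∀ m j → binomialTail m j ≤ fromℕ (m C j) * p ^ j
    binomialTail≤ zero    zero    = ℚ.≤-refl
    binomialTail≤ zero    (suc j) = ℚ.≤-reflexive (sym (ℚ.*-zeroˡ (p ^ suc j)))
    binomialTail≤ (suc m) zero    = begin
      binomialTail (suc m) 0                  ≡⟨ binomialTail-suc m 0 ⟩
      p * binomialTail m 0 + q * binomialTail m 0
        ≤⟨ ℚ.+-mono-≤ (*-monoˡ-≤ 0≤p (binomialTail≤ m 0)) (*-monoˡ-≤ 0≤q (binomialTail≤ m 0)) ⟩
      p * 1ℚ + q * 1ℚ                         ≡⟨ cong₂ _+_ (ℚ.*-identityʳ p) (ℚ.*-identityʳ q) ⟩
      p + q                                   ≤⟨ p+q≤1 ⟩
      1ℚ                                      ∎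
      where open ℚ.≤-Reasoning
    binomialTail≤ (suc m) (suc j) = begin
      binomialTail (suc m) (suc j)                        ≡⟨ binomialTail-suc m (suc j) ⟩
      p * binomialTail m j + q * binomialTail m (suc j)
        ≤⟨ ℚ.+-mono-≤ (*-monoˡ-≤ 0≤p (binomialTail≤ m j)) (*-monoˡ-≤ 0≤q (binomialTail≤ m (suc j))) ⟩
      p * (a * p ^ j) + q * (b * p ^ suc j)
        ≤⟨ ℚ.+-monoʳ-≤ (p * (a * p ^ j)) (≤1⇒*-≤ (0≤* (0≤fromℕ (m C suc j)) (0≤^ 0≤p (suc j))) q≤1) ⟩
      p * (a * p ^ j) + b * p ^ suc j                     ≡⟨ solve 4 (λ p a b x → p :* (a :* x) :+ b :* (p :* x) := (a :+ b) :* (p :* x)) refl p a b (p ^ j) ⟩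
      (a + b) * p ^ suc j                                 ≡⟨ cong (_* p ^ suc j) (sym (fromℕ-+ (m C j) (m C suc j))) ⟩
      fromℕ (m C j ℕ.+ m C suc j) * p ^ suc j             ≡⟨ cong (λ k → fromℕ k * p ^ suc j) (nCk+nC[k+1]≡[n+1]C[k+1] m j) ⟩
      fromℕ (suc m C suc j) * p ^ suc j                   ∎
      where
      open ℚ.≤-Reasoning
      open +-*-Solver
      a = fromℕ (m C j)
      b = fromℕ (m C suc j)

-- Isolated vertices and connectivity

module _ {n : ℕ} where

  Isolated : List (Fin n × Fin n) → Fin n → Set
  Isolated E u = All (λ e → proj₁ e ≢ u × proj₂ e ≢ u) E

  isolated⇒¬adjacent : ∀ {E u} → Isolated E u → ∀ v → ¬ T (adjacent E u v)
  isolated⇒¬adjacent []                    v ()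
  isolated⇒¬adjacent {(a , b) ∷ E} {u} ((a≢u , b≢u) ∷ iso) v with a Fin.≟ u | b Fin.≟ u | a Fin.≟ v
  ... | yes a≡u | _       | _ = contradiction a≡u a≢u
  ... | no _    | yes b≡u | _ = contradiction b≡u b≢u
  ... | no _    | no _    | yes _ = isolated⇒¬adjacent iso v
  ... | no _    | no _    | no _  = isolated⇒¬adjacent iso v

  reach-isolated : ∀ {E u} → Isolated E u → ∀ k {w} → T (reach E k u w) → u ≡ w
  reach-isolated iso zero    u↝w = toWitness u↝w
  reach-isolated {E} {u} iso (suc k) {w} u↝w with Equivalence.to T-∨ u↝w
  ... | inj₁ u↝w′ = reach-isolated iso k u↝w′
  ... | inj₂ step with satisfied (any⁻ (λ x → reach E k u x ∧ adjacent E x w) (allFin n) step)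
  ...   | x , u↝x∧x~w with Equivalence.to T-∧ u↝x∧x~w
  ...     | u↝x , x~w with reach-isolated iso k u↝x
  ...       | refl = contradiction x~w (isolated⇒¬adjacent iso w)

  connected⇒reach : ∀ {E} → T (connected E) → ∀ u v → T (reach E n u v)
  connected⇒reach {E} conn u v =
    All.lookup (all⁺ _ (allFin n) (All.lookup (all⁺ _ (allFin n) conn) (∈-allFin u))) (∈-allFin v)

  isolated⇒¬connected : ∀ {E u v} → Isolated E u → u ≢ v → ¬ T (connected E)
  isolated⇒¬connected {E} {u} {v} iso u≢v conn = u≢v (reach-isolated iso n (connected⇒reach conn u v))

avoid₂ : ∀ {k} (a b : Fin (3 ℕ.+ k)) → ∃[ u ] a ≢ u × b ≢ u
avoid₂ Fin.zero                 Fin.zero                 = Fin.suc Fin.zero , (λ ()) , (λ ())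
avoid₂ Fin.zero                 (Fin.suc Fin.zero)       = Fin.suc (Fin.suc Fin.zero) , (λ ()) , (λ ())
avoid₂ Fin.zero                 (Fin.suc (Fin.suc _))    = Fin.suc Fin.zero , (λ ()) , (λ ())
avoid₂ (Fin.suc Fin.zero)       Fin.zero                 = Fin.suc (Fin.suc Fin.zero) , (λ ()) , (λ ())
avoid₂ (Fin.suc (Fin.suc _))    Fin.zero                 = Fin.suc Fin.zero , (λ ()) , (λ ())
avoid₂ (Fin.suc _)              (Fin.suc _)              = Fin.zero , (λ ()) , (λ ())

avoid₁ : ∀ {k} (u : Fin (2 ℕ.+ k)) → ∃[ v ] u ≢ v
avoid₁ Fin.zero    = Fin.suc Fin.zero , λ ()
avoid₁ (Fin.suc _) = Fin.zero , λ ()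

≤1-edges⇒¬connected : ∀ {n} → 3 ℕ.≤ n → (E : List (Fin n × Fin n)) → length E ℕ.≤ 1 → ¬ T (connected E)
≤1-edges⇒¬connected {n} (s≤s (s≤s (s≤s _))) [] _ = isolated⇒¬connected {n} {u = Fin.zero} {v = Fin.suc Fin.zero} [] (λ ())
≤1-edges⇒¬connected {n} (s≤s (s≤s (s≤s _))) ((a , b) ∷ []) _ with avoid₂ a b
... | u , a≢u , b≢u = isolated⇒¬connected {n} ((a≢u , b≢u) ∷ []) (proj₂ (avoid₁ u))
≤1-edges⇒¬connected _ (_ ∷ _ ∷ _) (s≤s ())

connected⇒2≤length : ∀ {n} → 3 ℕ.≤ n → (E : List (Fin n × Fin n)) → T (connected E) → 2 ℕ.≤ length E
connected⇒2≤length 3≤n E conn = ℕₚ.≰⇒> (λ length≤1 → ≤1-edges⇒¬connected 3≤n E length≤1 conn)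

length-chosen≤countTrue : ∀ (E : List A) s → length (chosen E s) ℕ.≤ countTrue s
length-chosen≤countTrue []      s           = z≤n
length-chosen≤countTrue (e ∷ E) []          = z≤n
length-chosen≤countTrue (e ∷ E) (true ∷ s)  = s≤s (length-chosen≤countTrue E s)
length-chosen≤countTrue (e ∷ E) (false ∷ s) = length-chosen≤countTrue E s

-- The reliability polynomial of Kₙ

reliability≤ : ∀ {n} → 3 ℕ.≤ n → ∀ {x} → 0ℚ ≤ x → x ≤ 1ℚ → r n x ≤ fromℕ (mK n C 2) * (1ℚ - x) ^ 2
reliability≤ {n} 3≤n {x} 0≤x x≤1 = begin
  r n x
    ≡⟨ foldr-+-map (λ i → fromℕ (N n i) * (1ℚ - x) ^ i * x ^ (m ∸ i)) (upTo (suc m)) ⟩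
  Sum (λ i → fromℕ (N n i) * (1ℚ - x) ^ i * x ^ (m ∸ i)) (upTo (suc m))
    ≡⟨ Sum-cong (universal (λ i → ℚ.*-assoc (fromℕ (N n i)) ((1ℚ - x) ^ i) (x ^ (m ∸ i))) (upTo (suc m))) ⟩
  Sum (λ i → fromℕ (N n i) * v i) (upTo (suc m))
    ≡⟨ Sum-fibres isConnected countTrue v (suc m) (selections m) countTrue<suc ⟩
  Sum (λ s → 𝟙 (isConnected s) * v (countTrue s)) (selections m)
    ≤⟨ Sum-mono (All.map connected≤atLeastTwo (length-selections m)) ⟩
  binomialTail (1ℚ - x) x m 2
    ≤⟨ binomialTail≤ (1ℚ - x) x (p≤q⇒0≤q-p x≤1) 0≤x 1-x+x≤1 m 2 ⟩
  fromℕ (m C 2) * (1ℚ - x) ^ 2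
    ∎
  where
  open ℚ.≤-Reasoning
  m = mK n
  isConnected : List Bool → Bool
  isConnected s = connected (chosen (edgesK n) s)
  v : ℕ → ℚ
  v i = (1ℚ - x) ^ i * x ^ (m ∸ i)
  1-x+x≤1 : (1ℚ - x) + x ≤ 1ℚ
  1-x+x≤1 = ℚ.≤-reflexive (solve 1 (λ x → con 1ℚ :- x :+ x := con 1ℚ) refl x)
    where open +-*-Solver
  countTrue<suc : All (λ s → countTrue s ℕ.< suc m) (selections m)
  countTrue<suc = All.map (λ {s} len≡m → s≤s (subst (countTrue s ℕ.≤_) len≡m (countTrue≤length s))) (length-selections m)
  0≤v : ∀ i → 0ℚ ≤ v i
  0≤v i = 0≤* (0≤^ (p≤q⇒0≤q-p x≤1) i) (0≤^ 0≤x (m ∸ i))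
  v≡weight : ∀ {s} → length s ≡ m → v (countTrue s) ≡ weight (1ℚ - x) x s
  v≡weight {s} len≡m = trans (cong (λ k → (1ℚ - x) ^ countTrue s * x ^ (k ∸ countTrue s)) (sym len≡m))
                             (sym (weight≡^ (1ℚ - x) x s))
  connected⇒2≤countTrue : ∀ s → T (isConnected s) → T (2 ℕ.≤ᵇ countTrue s)
  connected⇒2≤countTrue s conn =
    ℕₚ.≤⇒≤ᵇ (ℕₚ.≤-trans (connected⇒2≤length 3≤n _ conn) (length-chosen≤countTrue (edgesK n) s))
  connected≤atLeastTwo : ∀ {s} → length s ≡ m →
    𝟙 (isConnected s) * v (countTrue s) ≤ 𝟙 (2 ℕ.≤ᵇ countTrue s) * weight (1ℚ - x) x s
  connected≤atLeastTwo {s} len≡m = begin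
    𝟙 (isConnected s) * v (countTrue s)          ≤⟨ 𝟙-mono (connected⇒2≤countTrue s) (0≤v (countTrue s)) ⟩
    𝟙 (2 ℕ.≤ᵇ countTrue s) * v (countTrue s)     ≡⟨ cong (𝟙 (2 ℕ.≤ᵇ countTrue s) *_) (v≡weight {s} len≡m) ⟩
    𝟙 (2 ℕ.≤ᵇ countTrue s) * weight (1ℚ - x) x s ∎

-- Continuity of polynomials at 1

coeffSum : List ℚ → ℚ
coeffSum []       = 0ℚ
coeffSum (a ∷ as) = ∣ a ∣ + coeffSum as

-- Σᵢ i ∣aᵢ∣ for P = [a₀, a₁, …]
lipschitzConstant : List ℚ → ℚ
lipschitzConstant []       = 0ℚ
lipschitzConstant (a ∷ as) = lipschitzConstant as + coeffSum as

0≤coeffSum : ∀ P → 0ℚ ≤ coeffSum P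
0≤coeffSum []       = ℚ.≤-refl
0≤coeffSum (a ∷ as) = ℚ.+-mono-≤ (ℚ.0≤∣p∣ a) (0≤coeffSum as)

0≤lipschitzConstant : ∀ P → 0ℚ ≤ lipschitzConstant P
0≤lipschitzConstant []       = ℚ.≤-refl
0≤lipschitzConstant (a ∷ as) = ℚ.+-mono-≤ (0≤lipschitzConstant as) (0≤coeffSum as)

evalPoly≤coeffSum : ∀ P {x} → 0ℚ ≤ x → x ≤ 1ℚ → evalPoly P x ≤ coeffSum P
evalPoly≤coeffSum []       0≤x x≤1 = ℚ.≤-refl
evalPoly≤coeffSum (a ∷ as) 0≤x x≤1 = ℚ.+-mono-≤ (p≤∣p∣ a)
  (ℚ.≤-trans (*-monoˡ-≤ 0≤x (evalPoly≤coeffSum as 0≤x x≤1)) (≤1⇒*-≤ (0≤coeffSum as) x≤1))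

evalPoly-1≤ : ∀ P {x} → 0ℚ ≤ x → x ≤ 1ℚ → evalPoly P 1ℚ ≤ evalPoly P x + (1ℚ - x) * lipschitzConstant P
evalPoly-1≤ []       {x} 0≤x x≤1 = ℚ.≤-reflexive (solve 1 (λ x → con 0ℚ := con 0ℚ :+ (con 1ℚ :- x) :* con 0ℚ) refl x)
  where open +-*-Solver
evalPoly-1≤ (a ∷ as) {x} 0≤x x≤1 = begin
  a + 1ℚ * P 1ℚ                           ≡⟨ cong (a +_) (ℚ.*-identityˡ (P 1ℚ)) ⟩
  a + P 1ℚ                                ≤⟨ ℚ.+-monoʳ-≤ a (evalPoly-1≤ as 0≤x x≤1) ⟩
  a + (P x + (1ℚ - x) * L)                ≡⟨ solve 4 (λ a px x l → a :+ (px :+ (con 1ℚ :- x) :* l)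
                                                     := a :+ x :* px :+ (con 1ℚ :- x) :* (l :+ px)) refl a (P x) x L ⟩
  a + x * P x + (1ℚ - x) * (L + P x)      ≤⟨ ℚ.+-monoʳ-≤ (a + x * P x)
                                               (*-monoˡ-≤ (p≤q⇒0≤q-p x≤1) (ℚ.+-monoʳ-≤ L (evalPoly≤coeffSum as 0≤x x≤1))) ⟩
  a + x * P x + (1ℚ - x) * (L + coeffSum as) ∎
  where
  open ℚ.≤-Reasoning
  open +-*-Solver
  P = evalPoly as
  L = lipschitzConstant as

≤-from-≤+ε : ∀ {a b L} → 0ℚ ≤ L → (∀ ε → 0ℚ < ε → ε ≤ 1ℚ → a ≤ b + ε * L) → a ≤ b
≤-from-≤+ε {a} {b} {L} 0≤L a≤b+εL with a ℚ.≤? b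
... | yes a≤b = a≤b
... | no  a≰b = contradiction (a≤b+εL ε 0<ε ε≤1) (λ a≤b+εL′ → ℚ.<-irrefl refl (ℚ.<-≤-trans b+εL<a a≤b+εL′))
  where
  open ℚ.≤-Reasoning
  d D ε : ℚ
  d = a - b
  D = d + (L + 1ℚ)
  0<d : 0ℚ < d
  0<d = p<q⇒0<q-p (ℚ.≰⇒> a≰b)
  d≤D : d ≤ D
  d≤D = subst (_≤ D) (ℚ.+-identityʳ d) (ℚ.+-monoʳ-≤ d (ℚ.+-mono-≤ 0≤L 0≤1))
  L<D : L < D
  L<D = begin-strict
    L               ≡⟨ ℚ.+-identityʳ L ⟨
    L + 0ℚ          <⟨ ℚ.+-monoʳ-< L (ℚ.positive⁻¹ 1ℚ) ⟩
    L + 1ℚ          ≡⟨ ℚ.+-identityˡ (L + 1ℚ) ⟨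
    0ℚ + (L + 1ℚ)   <⟨ ℚ.+-monoˡ-< (L + 1ℚ) 0<d ⟩
    D               ∎
  instance
    D-pos : Positive D
    D-pos = positive (ℚ.<-≤-trans 0<d d≤D)
    d-pos : Positive d
    d-pos = positive 0<d
    D-nonZero : NonZero D
    D-nonZero = ℚ.pos⇒nonZero D
  1/D-pos : Positive (1/ D)
  1/D-pos = ℚ.1/pos⇒pos D
  ε = d * 1/ D
  0<ε : 0ℚ < ε
  0<ε = ℚ.positive⁻¹ ε {{ℚ.pos*pos⇒pos d (1/ D) {{1/D-pos}}}}
  ε≤1 : ε ≤ 1ℚ
  ε≤1 = begin
    d * 1/ D        ≤⟨ *-monoʳ-≤ (ℚ.<⇒≤ (ℚ.positive⁻¹ (1/ D) {{1/D-pos}})) d≤D ⟩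
    D * 1/ D        ≡⟨ ℚ.*-inverseʳ D ⟩
    1ℚ              ∎
  b+εL<a : b + ε * L < a
  b+εL<a = begin-strict
    b + ε * L             ≡⟨ cong (b +_) (ℚ.*-assoc d (1/ D) L) ⟩
    b + d * (1/ D * L)    <⟨ ℚ.+-monoʳ-< b (ℚ.*-monoʳ-<-pos d (ℚ.*-monoʳ-<-pos (1/ D) {{1/D-pos}} L<D)) ⟩
    b + d * (1/ D * D)    ≡⟨ cong (λ t → b + d * t) (ℚ.*-inverseˡ D) ⟩
    b + d * 1ℚ            ≡⟨ solve 2 (λ a b → b :+ (a :- b) :* con 1ℚ := a) refl a b ⟩
    a                     ∎
    where open +-*-Solver

evalPoly-≤-closure : ∀ P {b} → (∀ x → 0ℚ ≤ x → x < 1ℚ → evalPoly P x ≤ b) →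
                     ∀ x → 0ℚ ≤ x → x ≤ 1ℚ → evalPoly P x ≤ b
evalPoly-≤-closure P {b} below x 0≤x x≤1 with x ℚ.<? 1ℚ
... | yes x<1 = below x 0≤x x<1
... | no  x≮1 rewrite ℚ.≤-antisym x≤1 (ℚ.≮⇒≥ x≮1) = ≤-from-≤+ε (0≤lipschitzConstant P) λ ε 0<ε ε≤1 →
  let 0≤1-ε = p≤q⇒0≤q-p ε≤1
      1-ε<1 = ℚ.+-monoʳ-< 1ℚ (ℚ.neg-antimono-< 0<ε)
  in begin
    evalPoly P 1ℚ                                               ≤⟨ evalPoly-1≤ P 0≤1-ε (ℚ.<⇒≤ 1-ε<1) ⟩
    evalPoly P (1ℚ - ε) + (1ℚ - (1ℚ - ε)) * lipschitzConstant P ≤⟨ ℚ.+-monoˡ-≤ _ (below (1ℚ - ε) 0≤1-ε 1-ε<1) ⟩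
    b + (1ℚ - (1ℚ - ε)) * lipschitzConstant P                   ≡⟨ cong (λ t → b + t * lipschitzConstant P)
                                                                     (solve 1 (λ ε → con 1ℚ :- (con 1ℚ :- ε) := ε) refl ε) ⟩
    b + ε * lipschitzConstant P                                 ∎
  where
  open ℚ.≤-Reasoning
  open +-*-Solver

-- Counting edges of Kₙ

length-filter-tabulate : ∀ {n} {B : Set} {P : Pred A 0ℓ} {Q : Pred B 0ℓ} (P? : Decidable P) (Q? : Decidable Q)
  (f : Fin n → A) (g : Fin n → B) → (∀ i → does (P? (f i)) ≡ does (Q? (g i))) →
  length (filter P? (tabulate f)) ≡ length (filter Q? (tabulate g))
length-filter-tabulate {n = zero}  P? Q? f g P≡Q = refl
length-filter-tabulate {n = suc n} P? Q? f g P≡Q with does (P? (f Fin.zero)) | does (Q? (g Fin.zero)) | P≡Q Fin.zero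
... | true  | true  | refl = cong suc (length-filter-tabulate P? Q? (f ∘ Fin.suc) (g ∘ Fin.suc) (P≡Q ∘ Fin.suc))
... | false | false | refl = length-filter-tabulate P? Q? (f ∘ Fin.suc) (g ∘ Fin.suc) (P≡Q ∘ Fin.suc)

length-concatMap-cong : ∀ {B C : Set} {f : A → List B} {g : A → List C} → (∀ x → length (f x) ≡ length (g x)) →
  ∀ xs → length (concatMap f xs) ≡ length (concatMap g xs)
length-concatMap-cong f≈g []       = refl
length-concatMap-cong {f = f} {g} f≈g (x ∷ xs) = begin
  length (f x ++ concatMap f xs)                ≡⟨ List.length-++ (f x) ⟩
  length (f x) ℕ.+ length (concatMap f xs)      ≡⟨ cong₂ ℕ._+_ (f≈g x) (length-concatMap-cong f≈g xs) ⟩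
  length (g x) ℕ.+ length (concatMap g xs)      ≡⟨ List.length-++ (g x) ⟨
  length (g x ++ concatMap g xs)                ∎
  where open ≡-Reasoning

-- The edges of Kₙ₊₁ are the n edges at vertex 0 and a copy of Kₙ on the other vertices.
mK-suc : ∀ n → mK (suc n) ≡ n ℕ.+ mK n
mK-suc n = begin
  length (edgesFrom Fin.zero ++ concatMap edgesFrom others)                ≡⟨ List.length-++ (edgesFrom Fin.zero) ⟩
  length (edgesFrom Fin.zero) ℕ.+ length (concatMap edgesFrom others)      ≡⟨ cong₂ ℕ._+_ length-edgesFrom-zero length-others ⟩
  n ℕ.+ mK n                                                               ∎
  where
  open ≡-Reasoning
  others : List (Fin (suc n))
  others = tabulate Fin.suc
  edgesFrom : Fin (suc n) → List (Fin (suc n) × Fin (suc n))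
  edgesFrom i = map (i ,_) (filter (λ j → toℕ i ℕ.<? toℕ j) (allFin (suc n)))
  length-edgesFrom-zero : length (edgesFrom Fin.zero) ≡ n
  length-edgesFrom-zero = begin
    length (edgesFrom Fin.zero)                     ≡⟨ List.length-map (Fin.zero ,_) (filter (λ j → 0 ℕ.<? toℕ j) (tabulate {n = n} Fin.suc)) ⟩
    length (filter (λ j → 0 ℕ.<? toℕ j) others)     ≡⟨ cong length (List.filter-all (λ j → 0 ℕ.<? toℕ j) (tabulate⁺ {n = n} {f = Fin.suc} (λ _ → s≤s z≤n))) ⟩
    length others                                   ≡⟨ List.length-tabulate {n = n} Fin.suc ⟩
    n                                               ∎
  length-edgesFrom-suc : ∀ i → length (edgesFrom (Fin.suc i))
                               ≡ length (map (i ,_) (filter (λ j → toℕ i ℕ.<? toℕ j) (allFin n)))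
  length-edgesFrom-suc i = begin
    length (edgesFrom (Fin.suc i))
      ≡⟨ List.length-map (Fin.suc i ,_) (filter (λ j → suc (toℕ i) ℕ.<? toℕ j) (tabulate {n = n} Fin.suc)) ⟩
    length (filter (λ j → suc (toℕ i) ℕ.<? toℕ j) others)
      ≡⟨ length-filter-tabulate {n = n} (λ j → suc (toℕ i) ℕ.<? toℕ j) (λ j → toℕ i ℕ.<? toℕ j) Fin.suc id (λ _ → refl) ⟩
    length (filter (λ j → toℕ i ℕ.<? toℕ j) (allFin n))
      ≡⟨ List.length-map (i ,_) (filter (λ j → toℕ i ℕ.<? toℕ j) (allFin n)) ⟨
    length (map (i ,_) (filter (λ j → toℕ i ℕ.<? toℕ j) (allFin n)))
      ∎
  length-others : length (concatMap edgesFrom others) ≡ mK n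
  length-others = begin
    length (concatMap edgesFrom others)                    ≡⟨ cong (length ∘ concatMap edgesFrom) (List.map-tabulate id Fin.suc) ⟨
    length (concatMap edgesFrom (map Fin.suc (allFin n)))  ≡⟨ cong length (List.concatMap-map edgesFrom Fin.suc (allFin n)) ⟩
    length (concatMap (edgesFrom ∘ Fin.suc) (allFin n))    ≡⟨ length-concatMap-cong length-edgesFrom-suc (allFin n) ⟩
    mK n                                                   ∎

mK≡C2 : ∀ n → mK n ≡ n C 2
mK≡C2 zero    = refl
mK≡C2 (suc n) = begin
  mK (suc n)            ≡⟨ mK-suc n ⟩
  n ℕ.+ mK n            ≡⟨ cong₂ ℕ._+_ (sym (nC1≡n n)) (mK≡C2 n) ⟩
  n C 1 ℕ.+ n C 2       ≡⟨ nCk+nC[k+1]≡[n+1]C[k+1] n 1 ⟩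
  suc n C 2             ∎
  where open ≡-Reasoning

C2+C2+n≡n*n : ∀ n → n C 2 ℕ.+ n C 2 ℕ.+ n ≡ n ℕ.* n
C2+C2+n≡n*n zero    = refl
C2+C2+n≡n*n (suc n) = begin
  suc n C 2 ℕ.+ suc n C 2 ℕ.+ suc n        ≡⟨ cong (λ c → c ℕ.+ c ℕ.+ suc n) (nCk+nC[k+1]≡[n+1]C[k+1] n 1) ⟨
  c₁ ℕ.+ c₂ ℕ.+ (c₁ ℕ.+ c₂) ℕ.+ suc n      ≡⟨ cong (λ c → c ℕ.+ c₂ ℕ.+ (c ℕ.+ c₂) ℕ.+ suc n) (nC1≡n n) ⟩
  n ℕ.+ c₂ ℕ.+ (n ℕ.+ c₂) ℕ.+ suc n        ≡⟨ solve 2 (λ n c → n :+ c :+ (n :+ c) :+ (con 1 :+ n) := (c :+ c :+ n) :+ (con 1 :+ n :+ n)) refl n c₂ ⟩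
  (c₂ ℕ.+ c₂ ℕ.+ n) ℕ.+ (suc n ℕ.+ n)      ≡⟨ cong (ℕ._+ (suc n ℕ.+ n)) (C2+C2+n≡n*n n) ⟩
  n ℕ.* n ℕ.+ (suc n ℕ.+ n)                ≡⟨ solve 1 (λ n → n :* n :+ (con 1 :+ n :+ n) := (con 1 :+ n) :* (con 1 :+ n)) refl n ⟩
  suc n ℕ.* suc n                          ∎
  where
  open ≡-Reasoning
  open ℕ-Solver
  c₁ = n C 1
  c₂ = n C 2

fromℕ-C2≤½*square : ∀ n → fromℕ (n C 2) ≤ ½ * fromℕ (n ℕ.* n)
fromℕ-C2≤½*square n = begin
  c                                ≤⟨ subst (_≤ c + ½ * fromℕ n) (ℚ.+-identityʳ c)
                                        (ℚ.+-monoʳ-≤ c (0≤* (ℚ.<⇒≤ (ℚ.positive⁻¹ ½)) (0≤fromℕ n))) ⟩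
  c + ½ * fromℕ n                  ≡⟨ solve 2 (λ c n → c :+ con ½ :* n := con ½ :* (c :+ c :+ n)) refl c (fromℕ n) ⟩
  ½ * (c + c + fromℕ n)            ≡⟨ cong (½ *_) (trans (fromℕ-+ (n C 2 ℕ.+ n C 2) n) (cong (_+ fromℕ n) (fromℕ-+ (n C 2) (n C 2)))) ⟨
  ½ * fromℕ (n C 2 ℕ.+ n C 2 ℕ.+ n) ≡⟨ cong (λ k → ½ * fromℕ k) (C2+C2+n≡n*n n) ⟩
  ½ * fromℕ (n ℕ.* n)              ∎
  where
  open ℚ.≤-Reasoning
  open +-*-Solver
  c = fromℕ (n C 2)

lemma3p2 : (n : ℕ) → n ≥ 3 →
    (Q : List ℚ) → (∀ q → r n q ≡ ((1ℚ - q) ^ 2) * evalPoly Q q) →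
    ∀ q → 0ℚ ≤ q → q ≤ 1ℚ → evalPoly Q q ≤ ½ * fromℕ ((n C 2) ℕ.* (n C 2))
lemma3p2 n 3≤n Q r≡[1-q]²Q q 0≤q q≤1 = begin
  evalPoly Q q                      ≤⟨ evalPoly-≤-closure Q below-1 q 0≤q q≤1 ⟩
  fromℕ (mK n C 2)                  ≡⟨ cong (λ m → fromℕ (m C 2)) (mK≡C2 n) ⟩
  fromℕ (n C 2 C 2)                 ≤⟨ fromℕ-C2≤½*square (n C 2) ⟩
  ½ * fromℕ ((n C 2) ℕ.* (n C 2))   ∎
  where
  open ℚ.≤-Reasoning
  below-1 : ∀ x → 0ℚ ≤ x → x < 1ℚ → evalPoly Q x ≤ fromℕ (mK n C 2)
  below-1 x 0≤x x<1 = ℚ.*-cancelˡ-≤-pos ((1ℚ - x) ^ 2) {{positive (0<^ (p<q⇒0<q-p x<1) 2)}} (begin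
    (1ℚ - x) ^ 2 * evalPoly Q x       ≡⟨ r≡[1-q]²Q x ⟨
    r n x                             ≤⟨ reliability≤ 3≤n 0≤x (ℚ.<⇒≤ x<1) ⟩
    fromℕ (mK n C 2) * (1ℚ - x) ^ 2   ≡⟨ ℚ.*-comm (fromℕ (mK n C 2)) ((1ℚ - x) ^ 2) ⟩
    (1ℚ - x) ^ 2 * fromℕ (mK n C 2)   ∎)
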